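{- Let $\mathcal{G}$ be a simple directed graph, let $d\ge 2$, and let $(\{\sigma,\sigma'\},e)$ be an almost-$d$-simplex in $\mathcal{G}$. Let $\mathcal{H}=(V_{\mathcal H},E_{\mathcal H})$ be the graph with $V_{\mathcal H}=\mathrm{Ver}(\sigma)\cup\mathrm{Ver}(\sigma')$ and $E_{\mathcal H}=\mathrm{Edg}(\sigma)\cup\mathrm{Edg}(\sigma')\cup\{e\}$. Then the directed flag complex of $\mathcal{H}$ contains exactly one $d$-simplex $\bar\sigma$.
   Context: A simple directed graph is a pair $\mathcal G=(V,E)$ with $V$ finite and $E\subseteq (V\times V)\setminus\{(v,v):v\in V\}$ (reciprocal edges allowed, no self-loops). A $d$-simplex of $\mathcal G$ is a tuple $\sigma=(v_0,\dots,v_d)$ of distinct vertices with $(v_i,v_j)\in E$ for all $0\le i<j\le d$; $\mathrm{Ver}(\sigma)=\{v_0,\dots,v_d\}$ and $\mathrm{Edg}(\sigma)=\{(v_i,v_j):0\le i<j\le d\}$. The directed flag complex of $\mathcal G$ is the collection of all its simplices (of all dimensions). For $i\in\{0,\dots,d\}$ the boundary map is $\partial_i(v_0,\dots,v_d)=(v_0,\dots,v_{i-1},v_{i+1},\dots,v_d)$. For $d\ge2$, an almost-$d$-simplex in $\mathcal G$ is a tuple $(\{\sigma,\sigma'\},e)$ where $\sigma=(v_0,\dots,v_{d-1})$ and $\sigma'=(v'_0,\dots,v'_{d-1})$ are $(d-1)$-simplices of $\mathcal G$ and $e$ is an ordered pair of vertices (not necessarily an edge of $\mathcal G$) such that there exist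 $i,i'\in\{0,\dots,d-1\}$ with (1) $\partial_i(\sigma)=\partial_{i'}(\sigma')$, (2) $v_i\ne v'_{i'}$, and (3) $e=(v_i,v'_{i'})$, allowed only if $i\le i'$, or $e=(v'_{i'},v_i)$, allowed only if $i'\le i$. For $d=1$, an almost-1-simplex is $(\{v,v'\},(v,v'))$ for vertices $v\neq v'$. -}

module Defs where

open import Data.Nat using (ℕ; zero; suc)
open import Data.Fin using (Fin) renaming (_<_ to _<ᶠ_; _≤_ to _≤ᶠ_)
open import Data.Vec using (Vec; lookup; removeAt)
open import Data.Vec.Membership.Propositional using (_∈_)
open import Data.Product using (Σ; ∃; _×_; _,_)
open import Data.Sum using (_⊎_)
open import Data.Empty using (⊥)
open import Relation.Nullary using (¬_)
open import Relation.Binary.PropositionalEquality using (_≡_; _≢_)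

-- A simple directed graph whose (finite) vertex set is a subset `Ver` of Fin n
-- and whose edge set is a relation `E`; no self-loops, reciprocal edges allowed.
record Graph (n : ℕ) : Set₁ where
  field
    Ver      : Fin n → Set
    E        : Fin n → Fin n → Set
    E-in-Ver : ∀ {u v} → E u v → Ver u × Ver v
    loopless : ∀ v → ¬ E v v
open Graph public

record IsSimplexOn {n : ℕ} (Vr : Fin n → Set) (Ed : Fin n → Fin n → Set)
                   (k : ℕ) (τ : Vec (Fin n) (suc k)) : Set where
  field
    vertices : ∀ i → Vr (lookup τ i)
    distinct : ∀ i j → lookup τ i ≡ lookup τ j → i ≡ j
    edges    : ∀ i j → i <ᶠ j → Ed (lookup τ i) (lookup τ j)

IsSimplex : ∀ {n} → Graph n → (k : ℕ) → Vec (Fin n) (suc k) → Set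
IsSimplex G = IsSimplexOn (Ver G) (E G)

Edg : ∀ {n k} → Vec (Fin n) k → Fin n → Fin n → Set
Edg σ u v = ∃ λ i → ∃ λ j → i <ᶠ j × lookup σ i ≡ u × lookup σ j ≡ v

record AS {n : ℕ} (G : Graph n) (m : ℕ) : Set where
  field
    σ σ'     : Vec (Fin n) (suc m)
    σ-simp   : IsSimplex G m σ
    σ'-simp  : IsSimplex G m σ'
    e        : Fin n × Fin n
    i i'     : Fin (suc m)
    face     : removeAt σ i ≡ removeAt σ' i'
    distinct : lookup σ i ≢ lookup σ' i'
    e-ok     : (i ≤ᶠ i' × e ≡ (lookup σ i , lookup σ' i'))
             ⊎ (i' ≤ᶠ i × e ≡ (lookup σ' i' , lookup σ i))
open AS public

-- Almost-d-simplex in G (only meaningful for d ≥ 1; the theorem uses d ≥ 2).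
AlmostSimplex : ∀ {n} → Graph n → ℕ → Set
AlmostSimplex G zero    = ⊥
AlmostSimplex G (suc m) = AS G m

HVer : ∀ {n} {G : Graph n} {d} → AlmostSimplex G d → Fin n → Set
HVer {d = zero}  ()
HVer {d = suc m} a v = (v ∈ σ a) ⊎ (v ∈ σ' a)

HE : ∀ {n} {G : Graph n} {d} → AlmostSimplex G d → Fin n → Fin n → Set
HE {d = zero}  ()
HE {d = suc m} a u v = Edg (σ a) u v ⊎ Edg (σ' a) u v ⊎ ((u , v) ≡ e a)

-- Order the two faces so that i ≤ i' (otherwise exchange σ and σ').  Inserting
-- x' = σ'ᵢ' into σ directly after position i' gives a tuple τ whose faces at
-- positions i' + 1 and i are σ and σ' respectively; the two positions not shared
-- by these faces carry x = σᵢ before x'.  Hence the vertices and edges of H are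
-- exactly those of τ, so τ is a d-simplex of H.  Conversely, a d-simplex τ′ of H
-- reads off, position by position, a strictly increasing self-map of the
-- positions of τ; such a map is the identity, so τ′ = τ.  The argument does not
-- use d ≥ 2.
module Submission where

open import Defs
open import Data.Nat using (ℕ; suc; _≤_; z≤n; s≤s)
open import Data.Fin using (Fin)
open import Data.Vec using (Vec)
open import Data.Product using (∃; _×_)
open import Relation.Binary.PropositionalEquality using (_≡_)

open import Function using (_∘_; _⇔_; mk⇔; Equivalence)
import Function.Properties.Equivalence as ⇔
import Data.Nat.Properties as ℕ
open import Data.Fin using (zero; suc; inject₁; opposite; punchIn; punchOut; _≟_)
  renaming (_<_ to _<ᶠ_; _≤_ to _≤ᶠ_)
import Data.Fin.Properties as Finₚ
open import Data.Vec using (_∷_; lookup; insertAt; removeAt)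
import Data.Vec.Properties as Vecₚ
open import Data.Vec.Membership.Propositional using (_∈_)
open import Data.Vec.Membership.Propositional.Properties using (∈-lookup)
open import Data.Vec.Relation.Unary.Any using (index)
open import Data.Vec.Relation.Unary.Any.Properties using (lookup-index)
open import Data.Product using (_,_)
open import Data.Sum using (_⊎_; inj₁; inj₂; [_,_]′; swap; assocˡ; assocʳ; map₁)
open import Data.Empty using (⊥-elim)
open import Relation.Nullary using (yes; no)
open import Relation.Binary.Core using (_Preserves_⟶_)
open import Relation.Binary.PropositionalEquality
  using (_≢_; refl; sym; trans; cong; cong₂; subst; module ≡-Reasoning)

private
  variable
    A : Set
    n k : ℕ

inject₁-mono-< : {p q : Fin k} → p <ᶠ q → inject₁ p <ᶠ inject₁ q
inject₁-mono-< {p = p} {q} p<q rewrite Finₚ.toℕ-inject₁ p | Finₚ.toℕ-inject₁ q = p<q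

opposite-anti-< : {p q : Fin k} → p <ᶠ q → opposite q <ᶠ opposite p
opposite-anti-< {p = p} {q} p<q rewrite Finₚ.opposite-prop p | Finₚ.opposite-prop q =
  ℕ.∸-monoʳ-< (s≤s p<q) (Finₚ.toℕ<n q)

strictMono⇒≤ : ∀ {m} (g : Fin k → Fin m) → g Preserves _<ᶠ_ ⟶ _<ᶠ_ → ∀ p → p ≤ᶠ g p
strictMono⇒≤ g mono zero    = z≤n
strictMono⇒≤ g mono (suc p) =
  ℕ.≤-<-trans (strictMono⇒≤ (g ∘ inject₁) (mono ∘ inject₁-mono-<) p)
              (mono (Finₚ.≤̄⇒inject₁< ℕ.≤-refl))

strictMono⇒≗id : (g : Fin k → Fin k) → g Preserves _<ᶠ_ ⟶ _<ᶠ_ → ∀ p → g p ≡ p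
strictMono⇒≗id g mono p = Finₚ.≤-antisym g[p]≤p (strictMono⇒≤ g mono p)
  where
  -- conjugating by the order reversal `opposite` turns the lower bound into an upper bound
  opposite-bound : opposite p ≤ᶠ opposite (g p)
  opposite-bound = subst (λ q → opposite p ≤ᶠ opposite (g q)) (Finₚ.opposite-involutive p)
    (strictMono⇒≤ (opposite ∘ g ∘ opposite) (opposite-anti-< ∘ mono ∘ opposite-anti-<) (opposite p))

  g[p]≤p : g p ≤ᶠ p
  g[p]≤p = ℕ.≮⇒≥ (ℕ.≤⇒≯ opposite-bound ∘ opposite-anti-<)

punchIn-mono-< : ∀ (P : Fin (suc k)) {p q} → p <ᶠ q → punchIn P p <ᶠ punchIn P q
punchIn-mono-< P {p} {q} p<q = Finₚ.≤∧≢⇒< (Finₚ.punchIn-mono-≤ P p q (ℕ.<⇒≤ p<q))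
  (Finₚ.<⇒≢ p<q ∘ Finₚ.punchIn-injective P p q)

punchOut-mono-< : {P p q : Fin (suc k)} (P≢p : P ≢ p) (P≢q : P ≢ q) →
                  p <ᶠ q → punchOut P≢p <ᶠ punchOut P≢q
punchOut-mono-< P≢p P≢q p<q = Finₚ.≤∧≢⇒< (Finₚ.punchOut-mono-≤ P≢p P≢q (ℕ.<⇒≤ p<q))
  (Finₚ.<⇒≢ p<q ∘ Finₚ.punchOut-injective P≢p P≢q)

Distinct : Vec A k → Set
Distinct xs = ∀ p q → lookup xs p ≡ lookup xs q → p ≡ q

lookup-ext : {xs ys : Vec A k} → (∀ p → lookup xs p ≡ lookup ys p) → xs ≡ ys
lookup-ext {xs = xs} {ys} eq =
  trans (sym (Vecₚ.tabulate∘lookup xs)) (trans (Vecₚ.tabulate-cong eq) (Vecₚ.tabulate∘lookup ys))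

lookup-removeAt : (xs : Vec A (suc k)) (P : Fin (suc k)) (p : Fin k) →
                  lookup (removeAt xs P) p ≡ lookup xs (punchIn P p)
lookup-removeAt xs P p =
  trans (cong (lookup (removeAt xs P)) (sym (Finₚ.punchOut-punchIn P))) (Vecₚ.removeAt-punchOut xs _)

lookup-insertAt-inject₁ : ∀ (xs : Vec A (suc k)) {i j} (v : A) → i ≤ᶠ j →
                          lookup (insertAt xs (suc j) v) (inject₁ i) ≡ lookup xs i
lookup-insertAt-inject₁ (x ∷ xs)     {zero}  {j}     v _           = refl
lookup-insertAt-inject₁ (x ∷ y ∷ xs) {suc i} {suc j} v (s≤s i≤j) =
  lookup-insertAt-inject₁ (y ∷ xs) v i≤j

removeAt-insertAt-comm : ∀ (xs : Vec A (suc k)) {i j} (v : A) → i ≤ᶠ j →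
  removeAt (insertAt xs (suc j) v) (inject₁ i) ≡ insertAt (removeAt xs i) j v
removeAt-insertAt-comm (x ∷ xs)     {zero}  {j}     v _           = refl
removeAt-insertAt-comm (x ∷ y ∷ xs) {suc i} {suc j} v (s≤s i≤j) =
  cong (x ∷_) (removeAt-insertAt-comm (y ∷ xs) v i≤j)

module _ (τ : Vec (Fin n) (suc k)) {P : Fin (suc k)} where

  ∈-removeAt⁺ : ∀ {v} → v ∈ removeAt τ P → v ∈ τ
  ∈-removeAt⁺ v∈ = subst (_∈ τ) (sym (trans (lookup-index v∈) (lookup-removeAt τ P (index v∈))))
                         (∈-lookup _ τ)

  ∈-removeAt⁻ : ∀ {p} → P ≢ p → lookup τ p ∈ removeAt τ P
  ∈-removeAt⁻ P≢p = subst (_∈ removeAt τ P) (Vecₚ.removeAt-punchOut τ P≢p) (∈-lookup _ _)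

  Edg-removeAt⁺ : ∀ {u v} → Edg (removeAt τ P) u v → Edg τ u v
  Edg-removeAt⁺ (p , q , p<q , refl , refl) =
    punchIn P p , punchIn P q , punchIn-mono-< P p<q ,
    sym (lookup-removeAt τ P p) , sym (lookup-removeAt τ P q)

  Edg-removeAt⁻ : ∀ {p q} → P ≢ p → P ≢ q → p <ᶠ q →
                  Edg (removeAt τ P) (lookup τ p) (lookup τ q)
  Edg-removeAt⁻ P≢p P≢q p<q =
    punchOut P≢p , punchOut P≢q , punchOut-mono-< P≢p P≢q p<q ,
    Vecₚ.removeAt-punchOut τ P≢p , Vecₚ.removeAt-punchOut τ P≢q

  removeAt-distinct⁻ : Distinct (removeAt τ P) → ∀ {p q} → P ≢ p → P ≢ q →
                       lookup τ p ≡ lookup τ q → p ≡ q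
  removeAt-distinct⁻ distinct P≢p P≢q eq = Finₚ.punchOut-injective P≢p P≢q
    (distinct _ _ (trans (Vecₚ.removeAt-punchOut τ P≢p)
                         (trans eq (sym (Vecₚ.removeAt-punchOut τ P≢q)))))

record IsGraphOf (Vr : Fin n → Set) (Ed : Fin n → Fin n → Set) (τ : Vec (Fin n) (suc k)) : Set₁ where
  field
    distinct : Distinct τ
    vertex⇔  : ∀ v → Vr v ⇔ v ∈ τ
    edge⇔    : ∀ u v → Ed u v ⇔ Edg τ u v

IsGraphOf-resp-⇔ : ∀ {Vr Vr′ : Fin n → Set} {Ed Ed′ : Fin n → Fin n → Set}
                     {τ : Vec (Fin n) (suc k)} →
  (∀ v → Vr′ v ⇔ Vr v) → (∀ u v → Ed′ u v ⇔ Ed u v) →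
  IsGraphOf Vr Ed τ → IsGraphOf Vr′ Ed′ τ
IsGraphOf-resp-⇔ Vr′⇔Vr Ed′⇔Ed g = record
  { distinct = g.distinct
  ; vertex⇔  = λ v → ⇔.trans (Vr′⇔Vr v) (g.vertex⇔ v)
  ; edge⇔    = λ u v → ⇔.trans (Ed′⇔Ed u v) (g.edge⇔ u v)
  }
  where module g = IsGraphOf g

IsGraphOf⇒unique-simplex : ∀ {Vr Ed} {τ : Vec (Fin n) (suc k)} → IsGraphOf Vr Ed τ →
  IsSimplexOn Vr Ed k τ × (∀ τ′ → IsSimplexOn Vr Ed k τ′ → τ′ ≡ τ)
IsGraphOf⇒unique-simplex {Vr = Vr} {Ed} {τ} g = τ-simplex , unique
  where
  module g = IsGraphOf g
  open Equivalence

  τ-simplex : IsSimplexOn Vr Ed _ τ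
  τ-simplex = record
    { vertices = λ p → from (g.vertex⇔ _) (∈-lookup p τ)
    ; distinct = g.distinct
    ; edges    = λ p q p<q → from (g.edge⇔ _ _) (p , q , p<q , refl , refl)
    }

  unique : ∀ τ′ → IsSimplexOn Vr Ed _ τ′ → τ′ ≡ τ
  unique τ′ τ′-simplex = lookup-ext λ p → trans (sym (τ[pos]≡τ′ p)) (cong (lookup τ) (pos≗id p))
    where
    module τ′ = IsSimplexOn τ′-simplex

    pos : Fin (suc _) → Fin (suc _)
    pos p = index (to (g.vertex⇔ _) (τ′.vertices p))

    τ[pos]≡τ′ : ∀ p → lookup τ (pos p) ≡ lookup τ′ p
    τ[pos]≡τ′ p = sym (lookup-index (to (g.vertex⇔ _) (τ′.vertices p)))

    pos-mono : pos Preserves _<ᶠ_ ⟶ _<ᶠ_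
    pos-mono {p} {q} p<q with to (g.edge⇔ _ _) (τ′.edges p q p<q)
    ... | a , b , a<b , τa≡τ′p , τb≡τ′q =
      subst (_<ᶠ pos q) (g.distinct _ _ (trans τa≡τ′p (sym (τ[pos]≡τ′ p))))
        (subst (a <ᶠ_) (g.distinct _ _ (trans τb≡τ′q (sym (τ[pos]≡τ′ q)))) a<b)

    pos≗id : ∀ p → pos p ≡ p
    pos≗id = strictMono⇒≗id pos pos-mono

module TwoFaces (τ : Vec (Fin n) (suc (suc k))) {L K : Fin (suc (suc k))} (L<K : L <ᶠ K) where

  private
    K≢L : K ≢ L
    K≢L = Finₚ.<⇒≢ L<K ∘ sym

  positions : ∀ p q → (K ≢ p × K ≢ q) ⊎ (L ≢ p × L ≢ q) ⊎ (p ≡ L × q ≡ K) ⊎ (p ≡ K × q ≡ L)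
  positions p q with K ≟ p | K ≟ q
  ... | no K≢p   | no K≢q   = inj₁ (K≢p , K≢q)
  ... | yes refl | yes refl = inj₂ (inj₁ (K≢L ∘ sym , K≢L ∘ sym))
  ... | yes refl | no K≢q with L ≟ q
  ...   | yes refl = inj₂ (inj₂ (inj₂ (refl , refl)))
  ...   | no L≢q   = inj₂ (inj₁ (K≢L ∘ sym , L≢q))
  positions p q | no K≢p | yes refl with L ≟ p
  ...   | yes refl = inj₂ (inj₂ (inj₁ (refl , refl)))
  ...   | no L≢p   = inj₂ (inj₁ (L≢p , K≢L ∘ sym))

  ∈-twoFaces : ∀ v → (v ∈ removeAt τ K ⊎ v ∈ removeAt τ L) ⇔ v ∈ τ
  ∈-twoFaces v = mk⇔ [ ∈-removeAt⁺ τ , ∈-removeAt⁺ τ ]′ split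
    where
    at : ∀ p → lookup τ p ∈ removeAt τ K ⊎ lookup τ p ∈ removeAt τ L
    at p with K ≟ p
    ... | yes refl = inj₂ (∈-removeAt⁻ τ (K≢L ∘ sym))
    ... | no K≢p   = inj₁ (∈-removeAt⁻ τ K≢p)

    split : v ∈ τ → v ∈ removeAt τ K ⊎ v ∈ removeAt τ L
    split v∈ = subst (λ w → w ∈ removeAt τ K ⊎ w ∈ removeAt τ L) (sym (lookup-index v∈))
                     (at (index v∈))

  Edg-twoFaces : ∀ u v →
    (Edg (removeAt τ K) u v ⊎ Edg (removeAt τ L) u v ⊎ (u , v) ≡ (lookup τ L , lookup τ K)) ⇔ Edg τ u v
  Edg-twoFaces u v = mk⇔ [ Edg-removeAt⁺ τ , [ Edg-removeAt⁺ τ , outer ]′ ]′ split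
    where
    outer : (u , v) ≡ (lookup τ L , lookup τ K) → Edg τ u v
    outer refl = L , K , L<K , refl , refl

    split : Edg τ u v → _
    split (p , q , p<q , refl , refl) with positions p q
    ... | inj₁ (K≢p , K≢q)                 = inj₁ (Edg-removeAt⁻ τ K≢p K≢q p<q)
    ... | inj₂ (inj₁ (L≢p , L≢q))          = inj₂ (inj₁ (Edg-removeAt⁻ τ L≢p L≢q p<q))
    ... | inj₂ (inj₂ (inj₁ (refl , refl))) = inj₂ (inj₂ refl)
    ... | inj₂ (inj₂ (inj₂ (refl , refl))) = ⊥-elim (Finₚ.<-asym p<q L<K)

  distinct-twoFaces : Distinct (removeAt τ K) → Distinct (removeAt τ L) →
                      lookup τ L ≢ lookup τ K → Distinct τ
  distinct-twoFaces dK dL τL≢τK p q eq with positions p q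
  ... | inj₁ (K≢p , K≢q)                 = removeAt-distinct⁻ τ dK K≢p K≢q eq
  ... | inj₂ (inj₁ (L≢p , L≢q))          = removeAt-distinct⁻ τ dL L≢p L≢q eq
  ... | inj₂ (inj₂ (inj₁ (refl , refl))) = ⊥-elim (τL≢τK eq)
  ... | inj₂ (inj₂ (inj₂ (refl , refl))) = ⊥-elim (τL≢τK (sym eq))

  twoFaces-graph : ∀ {s s′ ε} →
    removeAt τ K ≡ s → removeAt τ L ≡ s′ → (lookup τ L , lookup τ K) ≡ ε →
    Distinct s → Distinct s′ → lookup τ L ≢ lookup τ K →
    IsGraphOf (λ v → v ∈ s ⊎ v ∈ s′) (λ u v → Edg s u v ⊎ Edg s′ u v ⊎ (u , v) ≡ ε) τ
  twoFaces-graph refl refl refl ds ds′ τL≢τK = record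
    { distinct = distinct-twoFaces ds ds′ τL≢τK
    ; vertex⇔  = ∈-twoFaces
    ; edge⇔    = Edg-twoFaces
    }

module Glue {m} (σ σ′ : Vec (Fin n) (suc m)) {i i′ : Fin (suc m)}
            (face : removeAt σ i ≡ removeAt σ′ i′) (i≤i′ : i ≤ᶠ i′) where

  glued : Vec (Fin n) (suc (suc m))
  glued = insertAt σ (suc i′) (lookup σ′ i′)

  removeAt-glued-suc : removeAt glued (suc i′) ≡ σ
  removeAt-glued-suc = Vecₚ.removeAt-insertAt σ (suc i′) _

  removeAt-glued-inject₁ : removeAt glued (inject₁ i) ≡ σ′
  removeAt-glued-inject₁ = begin
    removeAt glued (inject₁ i)                        ≡⟨ removeAt-insertAt-comm σ _ i≤i′ ⟩
    insertAt (removeAt σ i) i′ (lookup σ′ i′)         ≡⟨ cong (λ s → insertAt s i′ (lookup σ′ i′)) face ⟩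
    insertAt (removeAt σ′ i′) i′ (lookup σ′ i′)       ≡⟨ Vecₚ.insertAt-removeAt σ′ i′ ⟩
    σ′                                                ∎
    where open ≡-Reasoning

  lookup-glued-inject₁ : lookup glued (inject₁ i) ≡ lookup σ i
  lookup-glued-inject₁ = lookup-insertAt-inject₁ σ (lookup σ′ i′) i≤i′

  lookup-glued-suc : lookup glued (suc i′) ≡ lookup σ′ i′
  lookup-glued-suc = Vecₚ.insertAt-lookup σ (suc i′) (lookup σ′ i′)

  glued-graph : ∀ {ε} → Distinct σ → Distinct σ′ → lookup σ i ≢ lookup σ′ i′ →
    ε ≡ (lookup σ i , lookup σ′ i′) →
    IsGraphOf (λ v → v ∈ σ ⊎ v ∈ σ′) (λ u v → Edg σ u v ⊎ Edg σ′ u v ⊎ (u , v) ≡ ε) glued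
  glued-graph dσ dσ′ x≢x′ refl =
    TwoFaces.twoFaces-graph glued (Finₚ.≤̄⇒inject₁< i≤i′)
      removeAt-glued-suc removeAt-glued-inject₁ (cong₂ _,_ lookup-glued-inject₁ lookup-glued-suc) dσ dσ′
      (λ eq → x≢x′ (trans (sym lookup-glued-inject₁) (trans eq lookup-glued-suc)))

almostSimplex-graph : ∀ {G : Graph n} {m} (a : AlmostSimplex G (suc m)) →
  ∃ λ τ → IsGraphOf (HVer a) (HE a) τ
almostSimplex-graph a with e-ok a
... | inj₁ (i≤i′ , e≡) =
  _ , Glue.glued-graph (σ a) (σ' a) (face a) i≤i′
        (IsSimplexOn.distinct (σ-simp a)) (IsSimplexOn.distinct (σ'-simp a)) (distinct a) e≡
... | inj₂ (i′≤i , e≡) =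
  _ , IsGraphOf-resp-⇔ (λ _ → mk⇔ swap swap) (λ _ _ → mk⇔ swap₁₂ swap₁₂)
        (Glue.glued-graph (σ' a) (σ a) (sym (face a)) i′≤i
          (IsSimplexOn.distinct (σ'-simp a)) (IsSimplexOn.distinct (σ-simp a)) (distinct a ∘ sym) e≡)
  where
  swap₁₂ : ∀ {B C D : Set} → B ⊎ C ⊎ D → C ⊎ B ⊎ D
  swap₁₂ = assocʳ ∘ map₁ swap ∘ assocˡ

lemma1 : ∀ {n} (G : Graph n) (d : ℕ) → 2 ≤ d → (a : AlmostSimplex G d) →
    ∃ λ (τ : Vec (Fin n) (suc d)) → IsSimplexOn (HVer a) (HE a) d τ
      × (∀ τ′ → IsSimplexOn (HVer a) (HE a) d τ′ → τ′ ≡ τ)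
lemma1 G (suc m) _ a with almostSimplex-graph a
... | τ , graph = τ , IsGraphOf⇒unique-simplex graph
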